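{- Let $\mathcal S$ be a finite subset of $\mathbb S$ whose elements pairwise almost commute. (1) If all the orbits of each $\pi\in\mathcal S$ are finite, then each element of $\Omega_{\mathcal S}$ is finite. (2) If, in addition, for each $\pi\in\mathcal S$ all orbits of $\pi$ have size at most $m(\pi)$, then all but finitely many elements of $\Omega_{\mathcal S}$ have cardinality at most $\prod_{\pi\in\mathcal S}m(\pi)$.
   Context: $\mathbb S$ is the symmetric group of $\mathbb N$. For $\pi,\pi'\in\mathbb S$, $\mathrm{NC}(\pi,\pi')=\{n:\pi(\pi'(n))\ne\pi'(\pi(n))\}$; $\pi,\pi'$ almost commute if $\mathrm{NC}(\pi,\pi')$ is finite. The orbit of $n$ under $\pi$ is $\{\pi^i(n):i\in\mathbb Z\}$. For $\mathcal S\subseteq\mathbb S$, $\equiv_{\mathcal S}$ is the transitive closure of the union of the equivalence relations whose classes are the orbits of the $\pi\in\mathcal S$, and $\Omega_{\mathcal S}$ is the set of equivalence classes of $\equiv_{\mathcal S}$. -}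

module Defs where

open import Level using (0ℓ)
open import Data.Nat using (ℕ; zero; suc; _*_; _≤_)
open import Data.Integer using (ℤ; +_; -[1+_])
open import Data.Fin using (Fin)
open import Data.List using (List; length)
open import Data.List.Membership.Propositional using (_∈_)
open import Data.Product using (Σ; ∃; _×_)
open import Relation.Binary.PropositionalEquality using (_≡_; _≢_)
open import Relation.Nullary using (¬_)
open import Function.Bundles using (_↔_; Inverse)
open import Relation.Binary.Construct.Closure.ReflexiveTransitive using (Star)

Perm : Set
Perm = ℕ ↔ ℕ

app : Perm → ℕ → ℕ
app π = Inverse.to π

appInv : Perm → ℕ → ℕ
appInv π = Inverse.from π

iter : (ℕ → ℕ) → ℕ → ℕ → ℕ
iter f zero    n = n
iter f (suc i) n = f (iter f i n)

pow : Perm → ℤ → ℕ → ℕ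
pow π (+ i)     n = iter (app π) i n
pow π -[1+ i ]  n = iter (appInv π) (suc i) n

Finite : (ℕ → Set) → Set
Finite P = Σ (List ℕ) λ xs → ∀ x → P x → x ∈ xs

CardAtMost : ℕ → (ℕ → Set) → Set
CardAtMost c P = Σ (List ℕ) λ xs → length xs ≤ c × (∀ x → P x → x ∈ xs)

NC : Perm → Perm → ℕ → Set
NC π π' n = app π (app π' n) ≢ app π' (app π n)

AlmostCommute : Perm → Perm → Set
AlmostCommute π π' = Finite (NC π π')

Orbit : Perm → ℕ → ℕ → Set
Orbit π n x = ∃ λ (i : ℤ) → pow π i n ≡ x

OrbitRel : ∀ {k} → (Fin k → Perm) → ℕ → ℕ → Set
OrbitRel {k} S n x = ∃ λ (i : Fin k) → Orbit (S i) n x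

EquivS : ∀ {k} → (Fin k → Perm) → ℕ → ℕ → Set
EquivS S = Star (OrbitRel S)

-- the element of Ω_S containing n
Class : ∀ {k} → (Fin k → Perm) → ℕ → ℕ → Set
Class S n x = EquivS S n x

-- the family lists distinct permutations (so it represents a finite set)
Distinct : ∀ {k} → (Fin k → Perm) → Set
Distinct {k} S = ∀ (i j : Fin k) → i ≢ j → ¬ (∀ n → app (S i) n ≡ app (S j) n)

prod : ∀ k → (Fin k → ℕ) → ℕ
prod zero    m = 1
prod (suc k) m = m Fin.zero * prod k (λ i → m (Fin.suc i))

-- Let B be the finite set of points at which two of the maps π^{±1} (π ∈ S) fail to
-- commute. Write points as sorted words π₁^{e₁} ⋯ π_k^{e_k} s over a fixed starting
-- point s. Applying a generator to a sorted word and pushing it to its own slot either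
-- succeeds, giving a sorted word over s, or gets stuck at a point b ∈ B, and then the
-- result is a sorted word over the seed g (h b), with g and h generators. Hence the
-- class of n consists of sorted words over n or over one of finitely many seeds, and
-- the sorted words over a fixed point number at most ∏ m(π). If some point of the class
-- of n is a sorted word over a seed, running the path back shows that n is too; so every
-- class containing none of the finitely many sorted words over seeds is small.
module Submission where

open import Defs
open import Data.Bool using (Bool; true; false; not)
open import Data.Empty using (⊥-elim)
open import Data.Fin using (Fin)
open import Data.Integer using (+_; -[1+_])
open import Data.List using (List; []; _∷_; [_]; map; concatMap; length; allFin; tabulate; cartesianProduct)
open import Data.List.Membership.Propositional using (_∈_; _∉_; lose)
open import Data.List.Membership.Propositional.Properties
  using (∈-map⁺; ∈-concatMap⁺; ∈-allFin; ∈-cartesianProduct⁺)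
open import Data.List.Properties using (length-++; map-tabulate)
open import Data.List.Relation.Unary.Any using (here; there)
open import Data.Nat using (ℕ; zero; suc; _+_; _*_; _≤_; z≤n)
open import Data.Nat.ListAction using (product)
open import Data.Nat.Properties using (_≟_; ≤-refl; ≤-trans; +-mono-≤; *-suc; *-monoʳ-≤; ≤-reflexive)
open import Data.List.Membership.DecPropositional _≟_ using (_∈?_)
open import Data.Product using (Σ; ∃; ∃₂; _×_; _,_; proj₁; proj₂)
open import Data.Sum using (_⊎_; inj₁; inj₂)
open import Function using (_∘_)
open import Function.Bundles using (Inverse)
open import Relation.Binary.Construct.Closure.ReflexiveTransitive using (ε; _◅_; reverse)
open import Relation.Binary.PropositionalEquality using (_≡_; refl; sym; trans; cong; subst; module ≡-Reasoning)
open import Relation.Nullary using (¬_; yes; no)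
open import Relation.Nullary.Decidable using (decidable-stable)

app-appInv : ∀ (π : Perm) y → app π (appInv π y) ≡ y
app-appInv π y = Inverse.inverseˡ π refl

appInv-app : ∀ (π : Perm) x → appInv π (app π x) ≡ x
appInv-app π x = Inverse.inverseʳ π refl

signed : Perm → Bool → ℕ → ℕ
signed π true  = app π
signed π false = appInv π

signed-not : ∀ π d x → signed π (not d) (signed π d x) ≡ x
signed-not π true  = appInv-app π
signed-not π false = app-appInv π

Letter : ℕ → Set
Letter k = Fin k × Bool

letter : ∀ {k} → (Fin k → Perm) → Letter k → ℕ → ℕ
letter S (i , d) = signed (S i) d

iter-suc : ∀ f n x → iter f (suc n) x ≡ iter f n (f x)
iter-suc f zero    x = refl
iter-suc f (suc n) x = cong f (iter-suc f n x)

iter-signed-not : ∀ π d n x → iter (signed π (not d)) n (iter (signed π d) n x) ≡ x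
iter-signed-not π d zero    x = refl
iter-signed-not π d (suc n) x = begin
  iter (signed π (not d)) (suc n) (iter (signed π d) (suc n) x)  ≡⟨ iter-suc (signed π (not d)) n _ ⟩
  iter (signed π (not d)) n (signed π (not d) (signed π d _))    ≡⟨ cong (iter (signed π (not d)) n) (signed-not π d _) ⟩
  iter (signed π (not d)) n (iter (signed π d) n x)              ≡⟨ iter-signed-not π d n x ⟩
  x                                                              ∎
  where open ≡-Reasoning

orbit-iter : ∀ π d n x → Orbit π x (iter (signed π d) n x)
orbit-iter π true  n       x = + n , refl
orbit-iter π false zero    x = + 0 , refl
orbit-iter π false (suc n) x = -[1+ n ] , refl

orbit⇒iter : ∀ {π x y} → Orbit π x y → ∃₂ λ d n → iter (signed π d) n x ≡ y
orbit⇒iter (+ n     , eq) = true  , n     , eq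
orbit⇒iter (-[1+ n ] , eq) = false , suc n , eq

orbit-refl : ∀ π x → Orbit π x x
orbit-refl π x = + 0 , refl

orbit-sym : ∀ {π x y} → Orbit π x y → Orbit π y x
orbit-sym {π} {x} o with orbit⇒iter o
... | d , n , refl = subst (Orbit π _) (iter-signed-not π d n x) (orbit-iter π (not d) n _)

orbit-signed : ∀ {π x y} d → Orbit π x y → Orbit π x (signed π d y)
orbit-signed         true  (+ n          , refl) = + suc n , refl
orbit-signed         false (+ zero       , refl) = -[1+ 0 ] , refl
orbit-signed {π}     false (+ suc n      , refl) = + n , sym (appInv-app π _)
orbit-signed {π}     true  (-[1+ zero ]  , refl) = + 0 , sym (app-appInv π _)
orbit-signed {π}     true  (-[1+ suc n ] , refl) = -[1+ n ] , sym (app-appInv π _)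
orbit-signed         false (-[1+ n ]     , refl) = -[1+ suc n ] , refl

CommuteAt : (ℕ → ℕ) → (ℕ → ℕ) → ℕ → Set
CommuteAt f g x = f (g x) ≡ g (f x)

pull : Perm → Bool → ℕ → ℕ
pull π true  q = q
pull π false q = appInv π q

push : Perm → Bool → ℕ → ℕ
push π true  q = q
push π false q = app π q

push-pull : ∀ π d q → push π d (pull π d q) ≡ q
push-pull π true  q = refl
push-pull π false q = app-appInv π q

commuteAt-signedˡ : ∀ π d {g q} → CommuteAt (app π) g (pull π d q) → CommuteAt (signed π d) g q
commuteAt-signedˡ π true  c = c
commuteAt-signedˡ π false {g} {q} c = begin
  appInv π (g q)                          ≡⟨ cong (appInv π ∘ g) (app-appInv π q) ⟨
  appInv π (g (app π (appInv π q)))       ≡⟨ cong (appInv π) c ⟨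
  appInv π (app π (g (appInv π q)))       ≡⟨ appInv-app π _ ⟩
  g (appInv π q)                          ∎
  where open ≡-Reasoning

commuteAt-signed : ∀ σ d τ e {q} → CommuteAt (app σ) (app τ) (pull σ d (pull τ e q)) →
  CommuteAt (signed σ d) (signed τ e) q
commuteAt-signed σ d τ e {q} c =
  sym (commuteAt-signedˡ τ e {signed σ d} {q} (sym (commuteAt-signedˡ σ d {app τ} {pull τ e q} c)))

commute-past-iter : ∀ {σ τ : ℕ → ℕ} (bad : List ℕ) → (∀ q → q ∉ bad → CommuteAt σ τ q) →
  ∀ n x → σ (iter τ n x) ≡ iter τ n (σ x) ⊎ ∃₂ λ t b → b ∈ bad × σ (iter τ n x) ≡ iter τ t (σ (τ b))
commute-past-iter bad comm zero x = inj₁ refl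
commute-past-iter {τ = τ} bad comm (suc n) x with iter τ n x ∈? bad
... | yes b∈ = inj₂ (0 , iter τ n x , b∈ , refl)
... | no b∉ with commute-past-iter bad comm n x
...   | inj₁ eq = inj₁ (trans (comm _ b∉) (cong τ eq))
...   | inj₂ (t , b , b∈ , eq) = inj₂ (suc t , b , b∈ , trans (comm _ b∉) (cong τ eq))

Enumeration : Set → Set
Enumeration I = Σ (List I) λ is → ∀ i → i ∈ is

enum-Fin : ∀ k → Enumeration (Fin k)
enum-Fin k = allFin k , ∈-allFin

enum-Bool : Enumeration Bool
enum-Bool = true ∷ false ∷ [] , λ { true → here refl ; false → there (here refl) }

enum-× : ∀ {I J} → Enumeration I → Enumeration J → Enumeration (I × J)
enum-× (is , i∈) (js , j∈) = cartesianProduct is js , λ (i , j) → ∈-cartesianProduct⁺ (i∈ i) (j∈ j)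

enum-Letter : ∀ k → Enumeration (Letter k)
enum-Letter k = enum-× (enum-Fin k) enum-Bool

Finite-⊆ : ∀ {P Q : ℕ → Set} → (∀ x → P x → Q x) → Finite Q → Finite P
Finite-⊆ P⊆Q (xs , covers) = xs , λ x → covers x ∘ P⊆Q x

Finite-⋃ : ∀ {I} {P : I → ℕ → Set} → Enumeration I → (∀ i → Finite (P i)) →
  Finite (λ x → ∃ λ i → P i x)
Finite-⋃ (is , i∈) fin =
  concatMap (proj₁ ∘ fin) is , λ { x (i , p) → ∈-concatMap⁺ (proj₁ ∘ fin) (lose (i∈ i) (proj₂ (fin i) x p)) }

Finite-image : ∀ (f : ℕ → ℕ) xs → Finite (λ y → ∃ λ x → x ∈ xs × f x ≡ y)
Finite-image f xs = map f xs , λ { _ (x , x∈ , refl) → ∈-map⁺ f x∈ }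

Finite-preimage : ∀ {P : ℕ → Set} (f g : ℕ → ℕ) → (∀ x → g (f x) ≡ x) → Finite P → Finite (P ∘ f)
Finite-preimage f g gf (xs , covers) = map g xs , λ x p → subst (_∈ map g xs) (gf x) (∈-map⁺ g (covers (f x) p))

length-concatMap-≤ : ∀ {A B : Set} (f : A → List B) c → (∀ x → length (f x) ≤ c) →
  ∀ xs → length (concatMap f xs) ≤ c * length xs
length-concatMap-≤ f c bound [] = z≤n
length-concatMap-≤ f c bound (x ∷ xs) = begin
  length (concatMap f (x ∷ xs))           ≡⟨ length-++ (f x) ⟩
  length (f x) + length (concatMap f xs)  ≤⟨ +-mono-≤ (bound x) (length-concatMap-≤ f c bound xs) ⟩
  c + c * length xs                       ≡⟨ *-suc c (length xs) ⟨
  c * length (x ∷ xs)                     ∎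
  where open Data.Nat.Properties.≤-Reasoning

product-tabulate : ∀ k (m : Fin k → ℕ) → product (tabulate m) ≡ prod k m
product-tabulate zero    m = refl
product-tabulate (suc k) m = cong (m Fin.zero *_) (product-tabulate k (m ∘ Fin.suc))

product-allFin : ∀ k (m : Fin k → ℕ) → product (map m (allFin k)) ≡ prod k m
product-allFin k m = trans (cong product (map-tabulate (λ i → i) m)) (product-tabulate k m)

module _ {k} (S : Fin k → Perm) where

  -- By commuteAt-signed, a signed pair fails to commute at q only if the plain pair
  -- fails at this point.
  Obstruction : Letter k × Letter k → ℕ → Set
  Obstruction ((i , d) , (j , e)) q = NC (S i) (S j) (pull (S i) d (pull (S j) e q))

  NonCommuting : ℕ → Set
  NonCommuting q = ∃ λ (gh : Letter k × Letter k) →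
    ¬ CommuteAt (letter S (proj₁ gh)) (letter S (proj₂ gh)) q

  noncommuting⇒obstruction : ∀ gh q →
    ¬ CommuteAt (letter S (proj₁ gh)) (letter S (proj₂ gh)) q → Obstruction gh q
  noncommuting⇒obstruction ((i , d) , (j , e)) q ¬c c = ¬c (commuteAt-signed (S i) d (S j) e c)

  noncommuting-finite : (∀ i j → AlmostCommute (S i) (S j)) → Finite NonCommuting
  noncommuting-finite ac =
    Finite-⊆ (λ q (gh , ¬c) → gh , noncommuting⇒obstruction gh q ¬c)
      (Finite-⋃ (enum-× (enum-Letter k) (enum-Letter k)) obstruction-finite)
    where
    obstruction-finite : ∀ gh → Finite (Obstruction gh)
    obstruction-finite ((i , d) , (j , e)) =
      Finite-preimage (pull (S i) d ∘ pull (S j) e) (push (S j) e ∘ push (S i) d)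
        (λ q → trans (cong (push (S j) e) (push-pull (S i) d _)) (push-pull (S j) e q))
        (ac i j)

  OrbitWalk : List (Fin k) → ℕ → ℕ → Set
  OrbitWalk []       s y = s ≡ y
  OrbitWalk (i ∷ is) s y = ∃ λ w → OrbitWalk is s w × Orbit (S i) w y

  walk-refl : ∀ is s → OrbitWalk is s s
  walk-refl []       s = refl
  walk-refl (i ∷ is) s = s , walk-refl is s , orbit-refl (S i) s

  module Covering (cover : Fin k → ℕ → List ℕ) (covers : ∀ i x y → Orbit (S i) x y → y ∈ cover i x) where

    walkCover : List (Fin k) → ℕ → List ℕ
    walkCover []       s = [ s ]
    walkCover (i ∷ is) s = concatMap (cover i) (walkCover is s)

    walk-covered : ∀ is {s y} → OrbitWalk is s y → y ∈ walkCover is s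
    walk-covered []       refl           = here refl
    walk-covered (i ∷ is) (w , walk , o) = ∈-concatMap⁺ (cover i) (lose (walk-covered is walk) (covers i _ _ o))

    walkCover-length : (m : Fin k → ℕ) → (∀ i x → length (cover i x) ≤ m i) →
      ∀ is s → length (walkCover is s) ≤ product (map m is)
    walkCover-length m bound []       s = ≤-refl
    walkCover-length m bound (i ∷ is) s =
      ≤-trans (length-concatMap-≤ (cover i) (m i) (bound i) (walkCover is s))
              (*-monoʳ-≤ (m i) (walkCover-length m bound is s))

  module NormalForm (bad : List ℕ) (commute : ∀ q → q ∉ bad → ∀ g h → CommuteAt (letter S g) (letter S h) q) where

    Seed : ℕ → Set
    Seed q = ∃ λ (gh : Letter k × Letter k) → ∃ λ b → b ∈ bad × letter S (proj₁ gh) (letter S (proj₂ gh) b) ≡ q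

    seed-finite : Finite Seed
    seed-finite = Finite-⋃ (enum-× (enum-Letter k) (enum-Letter k)) λ gh →
      Finite-image (λ b → letter S (proj₁ gh) (letter S (proj₂ gh) b)) bad

    Start : ℕ → ℕ → Set
    Start s s′ = s′ ≡ s ⊎ Seed s′

    start-trans : ∀ {s s′ s″} → Start s s′ → Start s′ s″ → Start s s″
    start-trans (inj₁ refl) st          = st
    start-trans (inj₂ seed) (inj₁ refl) = inj₂ seed
    start-trans _           (inj₂ seed) = inj₂ seed

    Reach : List (Fin k) → ℕ → ℕ → Set
    Reach is s y = ∃ λ s′ → Start s s′ × OrbitWalk is s′ y

    reach-extend : ∀ {is s w y} i → Reach is s w → Orbit (S i) w y → Reach (i ∷ is) s y
    reach-extend i (s′ , st , walk) o = s′ , st , _ , walk , o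

    walk-step : ∀ {is s y j} → OrbitWalk is s y → j ∈ is → ∀ d → Reach is s (signed (S j) d y)
    walk-step {i ∷ is} {s} (w , walk , o) (here refl) d = s , inj₁ refl , w , walk , orbit-signed d o
    walk-step {i ∷ is} {j = j} (w , walk , o) (there j∈) d with orbit⇒iter o
    ... | d₀ , n , refl
        with commute-past-iter bad (λ q q∉ → commute q q∉ (j , d) (i , d₀)) n w
    ... | inj₁ eq =
          reach-extend i (walk-step walk j∈ d) (subst (Orbit (S i) _) (sym eq) (orbit-iter (S i) d₀ n _))
    ... | inj₂ (t , b , b∈ , eq) =
          seed , inj₂ (((j , d) , (i , d₀)) , b , b∈ , refl) , seed , walk-refl is seed ,
          subst (Orbit (S i) seed) (sym eq) (orbit-iter (S i) d₀ t seed)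
      where seed = signed (S j) d (signed (S i) d₀ b)

    reach-signed : ∀ {is s y j} → j ∈ is → ∀ d → Reach is s y → Reach is s (signed (S j) d y)
    reach-signed j∈ d (s′ , st , walk) with walk-step walk j∈ d
    ... | s″ , st′ , walk′ = s″ , start-trans st st′ , walk′

    reach-iter : ∀ {is s y j} → j ∈ is → ∀ d n → Reach is s y → Reach is s (iter (signed (S j) d) n y)
    reach-iter j∈ d zero    r = r
    reach-iter j∈ d (suc n) r = reach-signed j∈ d (reach-iter j∈ d n r)

    reach-equiv : ∀ {is s y z} → (∀ j → j ∈ is) → Reach is s y → EquivS S y z → Reach is s z
    reach-equiv all r ε = r
    reach-equiv all r ((j , o) ◅ path) with orbit⇒iter o
    ... | d , n , refl = reach-equiv all (reach-iter (all j) d n r) path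

module AlmostCommuting {k} (S : Fin k → Perm) (ac : ∀ i j → AlmostCommute (S i) (S j)) where

  bad : List ℕ
  bad = proj₁ (noncommuting-finite S ac)

  commute : ∀ q → q ∉ bad → ∀ g h → CommuteAt (letter S g) (letter S h) q
  commute q q∉ g h = decidable-stable (_ ≟ _) λ ¬c → q∉ (proj₂ (noncommuting-finite S ac) q ((g , h) , ¬c))

  open NormalForm S bad commute

  seeds : List ℕ
  seeds = proj₁ seed-finite

  seed∈ : ∀ {s} → Seed s → s ∈ seeds
  seed∈ = proj₂ seed-finite _

  start∈ : ∀ {s s′} → Start s s′ → s′ ∈ s ∷ seeds
  start∈ (inj₁ refl) = here refl
  start∈ (inj₂ seed) = there (seed∈ seed)

  seed-start : ∀ {s s′} → Seed s → Start s s′ → Seed s′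
  seed-start seed (inj₁ refl) = seed
  seed-start _    (inj₂ seed) = seed

  orbitRel-sym : ∀ {x y} → OrbitRel S x y → OrbitRel S y x
  orbitRel-sym (i , o) = i , orbit-sym o

  class-reach : ∀ {n x} → Class S n x → Reach (allFin k) n x
  class-reach = reach-equiv ∈-allFin (_ , inj₁ refl , walk-refl S (allFin k) _)

  module _ (cover : Fin k → ℕ → List ℕ) (covers : ∀ i x y → Orbit (S i) x y → y ∈ cover i x) where
    open Covering S cover covers

    seeded : List ℕ
    seeded = concatMap (walkCover (allFin k)) seeds

    class-covered : ∀ {n x} → Class S n x → x ∈ concatMap (walkCover (allFin k)) (n ∷ seeds)
    class-covered cls with class-reach cls
    ... | s , st , walk = ∈-concatMap⁺ (walkCover (allFin k)) (lose (start∈ st) (walk-covered _ walk))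

    -- A point of the class of n lying over a seed leads back to n lying over a seed.
    class-covered-unless-seeded : ∀ {n x} → n ∉ seeded → Class S n x → x ∈ walkCover (allFin k) n
    class-covered-unless-seeded n∉ cls with class-reach cls
    ... | s , inj₁ refl , walk = walk-covered _ walk
    ... | s , inj₂ seed , walk
        with reach-equiv ∈-allFin (s , inj₁ refl , walk) (reverse orbitRel-sym cls)
    ...   | s′ , st , walk′ =
            ⊥-elim (n∉ (∈-concatMap⁺ (walkCover (allFin k)) (lose (seed∈ (seed-start seed st)) (walk-covered _ walk′))))

  class-finite : (∀ i n → Finite (Orbit (S i) n)) → ∀ n → Finite (Class S n)
  class-finite orbits n = _ , λ x → class-covered (λ i → proj₁ ∘ orbits i) (λ i → proj₂ ∘ orbits i)

  classes-small-but-finitely-many : ∀ m → (∀ i n → CardAtMost (m i) (Orbit (S i) n)) →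
    Σ (List ℕ) λ reps → ∀ n → CardAtMost (prod k m) (Class S n) ⊎ (∃ λ r → r ∈ reps × EquivS S n r)
  classes-small-but-finitely-many m small = seeded cover covers , small-or-seeded
    where
    cover : Fin k → ℕ → List ℕ
    cover i x = proj₁ (small i x)
    covers : ∀ i x y → Orbit (S i) x y → y ∈ cover i x
    covers i x = proj₂ (proj₂ (small i x))
    open Covering S cover covers
    small-or-seeded : ∀ n → CardAtMost (prod k m) (Class S n) ⊎ (∃ λ r → r ∈ seeded cover covers × EquivS S n r)
    small-or-seeded n with n ∈? seeded cover covers
    ... | yes n∈ = inj₂ (n , n∈ , ε)
    ... | no  n∉ = inj₁ (walkCover (allFin k) n ,
            ≤-trans (walkCover-length m (λ i x → proj₁ (proj₂ (small i x))) (allFin k) n)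
                    (≤-reflexive (product-allFin k m)) ,
            λ x → class-covered-unless-seeded cover covers n∉)

lemma3p1 : ∀ (k : ℕ) (S : Fin k → Perm) → Distinct S →
    (∀ (i j : Fin k) → AlmostCommute (S i) (S j)) →
    ((∀ (i : Fin k) (n : ℕ) → Finite (Orbit (S i) n)) →
      ∀ (n : ℕ) → Finite (Class S n))
    ×
    ((∀ (i : Fin k) (n : ℕ) → Finite (Orbit (S i) n)) →
      ∀ (m : Fin k → ℕ) →
      (∀ (i : Fin k) (n : ℕ) → CardAtMost (m i) (Orbit (S i) n)) →
      Σ (List ℕ) λ reps → ∀ (n : ℕ) →
        CardAtMost (prod k m) (Class S n) ⊎ (∃ λ r → r ∈ reps × EquivS S n r))
lemma3p1 k S _ ac = class-finite , λ _ → classes-small-but-finitely-many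
  where open AlmostCommuting S ac
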